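{- Let $T$ be a tree with maximum degree $\Delta$ and let $H$ be a graph of order $n$. Then $\chi_{\le 2}(T\diamond H)=(n+1)\Delta+1$.
   Context: For a simple graph $G$ with edges $e_1,\dots,e_m$ and a graph $H$, the edge corona product $G\diamond H$ is the graph obtained by taking one copy of $G$ and $m$ vertex-disjoint copies $H_1,\dots,H_m$ of $H$ and joining both end vertices of $e_i$ to every vertex of $H_i$, $1\le i\le m$. A $k$-distance coloring of a graph is a vertex coloring in which any two distinct vertices at distance at most $k$ receive different colors; $\chi_{\le k}$ denotes the minimum number of colors in a $k$-distance coloring. -}

module Defs where

open import Data.Nat using (ℕ; zero; suc; _+_; _*_; _≤_; _<_; _⊔_)
open import Data.Fin as F using (Fin)
open import Data.Bool using (Bool; true; false; if_then_else_)
open import Data.List using (List; []; _∷_; _++_; [_]; length; allFin; filter; map; foldr)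
open import Data.List.Relation.Unary.Unique.Propositional using (Unique)
open import Data.Product using (Σ; ∃; ∃-syntax; _×_; _,_; proj₁; proj₂)
open import Data.Sum using (_⊎_; inj₁; inj₂)
open import Relation.Binary.PropositionalEquality using (_≡_; _≢_)
open import Relation.Nullary using (¬_)
open import Data.Bool.Properties using (T?)
open import Data.Bool using (T)

record SimpleGraph (n : ℕ) : Set where
  field
    adj    : Fin n → Fin n → Bool
    sym    : ∀ i j → adj i j ≡ adj j i
    irrefl : ∀ i → adj i i ≡ false
open SimpleGraph public

record Graph : Set₁ where
  field
    V   : Set
    Adj : V → V → Set
open Graph public

toGraph : ∀ {n} → SimpleGraph n → Graph
toGraph {n} G = record { V = Fin n ; Adj = λ i j → adj G i j ≡ true }

data Walk (G : Graph) : V G → V G → ℕ → Set where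
  here : ∀ {u} → Walk G u u 0
  step : ∀ {u w v ℓ} → Adj G u w → Walk G w v ℓ → Walk G u v (suc ℓ)

DistLeq : (G : Graph) → V G → V G → ℕ → Set
DistLeq G u v k = ∃[ ℓ ] (ℓ ≤ k × Walk G u v ℓ)

Connected : Graph → Set
Connected G = ∀ u v → ∃[ ℓ ] Walk G u v ℓ

data AdjChain (G : Graph) : List (V G) → Set where
  nil  : AdjChain G []
  one  : ∀ x → AdjChain G (x ∷ [])
  cons : ∀ {x y xs} → Adj G x y → AdjChain G (y ∷ xs) → AdjChain G (x ∷ y ∷ xs)

-- a cycle x, y₁, …, yₖ, z, x with k ≥ 1 (so at least 3 distinct vertices)
HasCycle : Graph → Set
HasCycle G = ∃[ x ] ∃[ ys ] ∃[ z ]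
  ( 1 ≤ length ys
  × Unique (x ∷ ys ++ [ z ])
  × AdjChain G (x ∷ ys ++ [ z ])
  × Adj G z x )

IsTree : ∀ {t} → SimpleGraph t → Set
IsTree {t} T' = 1 ≤ t × Connected (toGraph T') × ¬ HasCycle (toGraph T')

degree : ∀ {t} → SimpleGraph t → Fin t → ℕ
degree {t} G v = length (filter (λ j → T? (adj G v j)) (allFin t))

maxDegree : ∀ {t} → SimpleGraph t → ℕ
maxDegree {t} G = foldr _⊔_ 0 (map (degree G) (allFin t))

-- edges of G, each unordered edge {i,j} represented once, as (i , j) with i < j
Edge : ∀ {t} → SimpleGraph t → Set
Edge {t} G = Σ (Fin t × Fin t) (λ p → (proj₁ p F.< proj₂ p) × adj G (proj₁ p) (proj₂ p) ≡ true)

ends : ∀ {t} {G : SimpleGraph t} → Edge G → Fin t × Fin t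
ends e = proj₁ e

IsEnd : ∀ {t} {G : SimpleGraph t} → Fin t → Edge G → Set
IsEnd {G = G} v e = v ≡ proj₁ (ends {G = G} e) ⊎ v ≡ proj₂ (ends {G = G} e)

CoronaV : ∀ {t n} → SimpleGraph t → SimpleGraph n → Set
CoronaV {t} {n} G H = Fin t ⊎ (Edge G × Fin n)

CoronaAdj : ∀ {t n} (G : SimpleGraph t) (H : SimpleGraph n) → CoronaV G H → CoronaV G H → Set
CoronaAdj G H (inj₁ u) (inj₁ v) = adj G u v ≡ true
CoronaAdj G H (inj₁ u) (inj₂ (e , x)) = IsEnd {G = G} u e
CoronaAdj G H (inj₂ (e , x)) (inj₁ u) = IsEnd {G = G} u e
CoronaAdj G H (inj₂ (e , x)) (inj₂ (e' , y)) = ends {G = G} e ≡ ends {G = G} e' × adj H x y ≡ true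

-- the edge corona product G ◇ H (copy H_e of H for each edge e of G)
edgeCorona : ∀ {t n} → SimpleGraph t → SimpleGraph n → Graph
edgeCorona G H = record { V = CoronaV G H ; Adj = CoronaAdj G H }

IsDistColoring : (G : Graph) (k m : ℕ) → (V G → Fin m) → Set
IsDistColoring G k m c = ∀ u v → u ≢ v → DistLeq G u v k → c u ≢ c v

ChiDist : (G : Graph) (k χ : ℕ) → Set
ChiDist G k χ =
  (∃[ c ] IsDistColoring G k χ c)
  × (∀ m (c : V G → Fin m) → IsDistColoring G k m c → χ ≤ m)

module Submission where

-- Lower bound (valid for every graph G in place of T): a vertex v of maximum degree,
-- its Δ neighbours and the n vertices of each of the Δ copies of H on the edges at v
-- are (n + 1)Δ + 1 distinct vertices, all adjacent to v and hence pairwise at distance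
-- at most 2; a 2-distance colouring separates them, so it needs that many colours.
--
-- Upper bound: for every graph G, a 2-distance colouring of G with a colours and an
-- edge colouring of G with b colours in which edges sharing an end vertex differ
-- combine into a 2-distance colouring of G ◇ H with a + b·n colours (vertex x of the
-- copy H_e gets the pair (colour of e, x)).  For a tree both colourings exist with
-- a = Δ + 1 and b = Δ: root T, number its vertices by breadth-first depth, observe
-- that (by acyclicity) every edge joins a vertex to its parent, and colour the
-- children of each vertex in turn, avoiding the colours of the parent and the
-- grandparent (for vertices) or of the parent edge (for edges).

open import Defs hiding (sym)
open import Data.Nat using (ℕ; zero; suc; _+_; _*_; _≤_; _<_; z≤n; s≤s; _<ᵇ_; _≡ᵇ_; _⊔_; _≤?_; _<?_)
open import Data.Nat.Properties
  using ( ≤-refl; ≤-trans; ≤-antisym; <-trans; <-≤-trans; ≤-<-trans; <-irrefl; <-asym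
        ; <-cmp; ≤-pred; n<1+n; n≤1+n; m≤n⇒m≤1+n; m<n⇒m<1+n; <⇒≢; ≮⇒≥; ≰⇒≥
        ; m≤m⊔n; m≤n⊔m; ⊔-sel; suc-injective; n≤0⇒n≡0; <⇒<ᵇ; <ᵇ⇒<; ≡⇒≡ᵇ; ≡ᵇ⇒≡ )
open import Data.Nat.Tactic.RingSolver using (solve-∀)
open import Data.Fin as Fin using (Fin; toℕ; fromℕ<; _↑ˡ_; _↑ʳ_; splitAt; join; combine; remQuot)
open import Data.Fin.Properties as FinP
  using (toℕ-injective; ↑ˡ-injective; ↑ʳ-injective; splitAt-↑ˡ; splitAt-↑ʳ
        ; combine-injective; join-splitAt; combine-remQuot; injective⇒≤)
open import Data.Bool as Bool using (Bool; true; false; _∧_) renaming (T to True)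
open import Data.Bool.Properties using (T?; T-∧; T-≡)
open import Data.List using (List; []; _∷_; _++_; [_]; length; allFin; filter; map; foldr; lookup)
open import Data.List.Relation.Unary.All as All using (All; []; _∷_)
import Data.List.Relation.Unary.All.Properties as All
open import Data.List.Relation.Unary.AllPairs using ([]; _∷_)
open import Data.List.Relation.Unary.Unique.Propositional using (Unique)
import Data.List.Relation.Unary.Unique.Propositional.Properties as Unique
open import Data.List.Relation.Unary.Any using (here; there)
open import Data.List.Membership.Propositional using (_∈_)
open import Data.List.Membership.Propositional.Properties using (∈-allFin; ∈-lookup; ∈-filter⁻)
open import Data.Product using (Σ; ∃; ∃-syntax; _×_; _,_; proj₁; proj₂)
import Data.Product as Product
open import Data.Sum using (_⊎_; inj₁; inj₂)
open import Data.Sum.Properties using (inj₁-injective; inj₂-injective)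
import Data.Sum as Sum
open import Data.Empty using (⊥; ⊥-elim)
open import Data.Unit using (tt)
open import Function.Bundles using (Equivalence)
open import Relation.Nullary using (¬_; Dec; yes; no)
open import Relation.Nullary.Decidable using (_⊎-dec_; _×-dec_)
open import Relation.Binary using (tri<; tri≈; tri>)
open import Relation.Binary.PropositionalEquality
  using (_≡_; _≢_; refl; sym; trans; cong; cong₂; subst; module ≡-Reasoning)
open import Axiom.UniquenessOfIdentityProofs using (module Decidable⇒UIP)

∧-split : ∀ {a b} → True (a ∧ b) → True a × True b
∧-split = Equivalence.to T-∧

∧-intro : ∀ {a b} → True a → True b → True (a ∧ b)
∧-intro p q = Equivalence.from T-∧ (p , q)

leastSatisfying : (P : ℕ → Set) → (∀ k → Dec (P k)) → ∀ ℓ → P ℓ →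
                  Σ ℕ λ m → P m × (∀ j → j < m → ¬ P j)
leastSatisfying P P? zero p = zero , p , λ j ()
leastSatisfying P P? (suc ℓ) p with P? zero
... | yes p₀ = zero , p₀ , λ j ()
... | no ¬p₀ with leastSatisfying (λ k → P (suc k)) (λ k → P? (suc k)) ℓ p
...   | m , pm , below = suc m , pm , λ { zero _ → ¬p₀ ; (suc j) (s≤s j<m) → below j j<m }

count : ∀ {A : Set} → (A → Bool) → List A → ℕ
count P xs = length (filter (λ x → T? (P x)) xs)

count-mono : ∀ {A : Set} (P Q : A → Bool) → (∀ x → True (P x) → True (Q x)) →
             ∀ xs → count P xs ≤ count Q xs
count-mono P Q P⇒Q [] = z≤n
count-mono P Q P⇒Q (x ∷ xs) with P x | Q x | P⇒Q x
... | true  | true  | _ = s≤s (count-mono P Q P⇒Q xs)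
... | true  | false | h = ⊥-elim (h tt)
... | false | true  | _ = m≤n⇒m≤1+n (count-mono P Q P⇒Q xs)
... | false | false | _ = count-mono P Q P⇒Q xs

count-strict : ∀ {A : Set} (P Q : A → Bool) → (∀ x → True (P x) → True (Q x)) →
               ∀ {y} xs → y ∈ xs → True (Q y) → ¬ True (P y) → count P xs < count Q xs
count-strict P Q P⇒Q (x ∷ xs) (here refl) Qy ¬Py with P x | Q x
... | true  | _     = ⊥-elim (¬Py tt)
... | false | true  = s≤s (count-mono P Q P⇒Q xs)
... | false | false = ⊥-elim Qy
count-strict P Q P⇒Q (x ∷ xs) (there y∈xs) Qy ¬Py with P x | Q x | P⇒Q x
... | true  | true  | _ = s≤s (count-strict P Q P⇒Q xs y∈xs Qy ¬Py)
... | true  | false | h = ⊥-elim (h tt)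
... | false | true  | _ = m<n⇒m<1+n (count-strict P Q P⇒Q xs y∈xs Qy ¬Py)
... | false | false | _ = count-strict P Q P⇒Q xs y∈xs Qy ¬Py

position : ∀ {t} → (Fin t → Bool) → Fin t → ℕ
position {t} P v = count (λ j → (toℕ j <ᵇ toℕ v) ∧ P j) (allFin t)

position<count : ∀ {t} (P : Fin t → Bool) {v} → True (P v) → position P v < count P (allFin t)
position<count {t} P {v} Pv =
  count-strict _ P (λ _ h → proj₂ (∧-split h)) (allFin t) (∈-allFin v) Pv
    (λ h → <-irrefl refl (<ᵇ⇒< (toℕ v) (toℕ v) (proj₁ (∧-split h))))

position-strictMono : ∀ {t} (P : Fin t → Bool) {a b} →
                      True (P a) → toℕ a < toℕ b → position P a < position P b
position-strictMono {t} P {a} {b} Pa a<b =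
  count-strict _ _
    (λ j h → ∧-intro (<⇒<ᵇ (<-trans (<ᵇ⇒< (toℕ j) (toℕ a) (proj₁ (∧-split h))) a<b))
                     (proj₂ (∧-split h)))
    (allFin t) (∈-allFin a) (∧-intro (<⇒<ᵇ a<b) Pa)
    (λ h → <-irrefl refl (<ᵇ⇒< (toℕ a) (toℕ a) (proj₁ (∧-split h))))

position-injective : ∀ {t} (P : Fin t → Bool) {a b} →
                     True (P a) → True (P b) → position P a ≡ position P b → a ≡ b
position-injective P {a} {b} Pa Pb eq with <-cmp (toℕ a) (toℕ b)
... | tri< a<b _ _ = ⊥-elim (<⇒≢ (position-strictMono P Pa a<b) eq)
... | tri≈ _ a≡b _ = toℕ-injective a≡b
... | tri> _ _ b<a = ⊥-elim (<⇒≢ (position-strictMono P Pb b<a) (sym eq))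

maxOf : ∀ {A : Set} → (A → ℕ) → List A → ℕ
maxOf f xs = foldr _⊔_ 0 (map f xs)

≤-maxOf : ∀ {A : Set} (f : A → ℕ) xs {x} → x ∈ xs → f x ≤ maxOf f xs
≤-maxOf f (y ∷ ys) (here refl) = m≤m⊔n (f y) _
≤-maxOf f (y ∷ ys) (there x∈ys) = ≤-trans (≤-maxOf f ys x∈ys) (m≤n⊔m (f y) _)

maxOf-attained : ∀ {A : Set} (f : A → ℕ) xs → maxOf f xs ≡ 0 ⊎ ∃ λ x → f x ≡ maxOf f xs
maxOf-attained f [] = inj₁ refl
maxOf-attained f (y ∷ ys) with ⊔-sel (f y) (maxOf f ys)
... | inj₁ max≡fy = inj₂ (y , sym max≡fy)
... | inj₂ max≡rest with maxOf-attained f ys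
...   | inj₁ rest≡0 = inj₁ (trans max≡rest rest≡0)
...   | inj₂ (x , fx≡rest) = inj₂ (x , trans fx≡rest (sym max≡rest))

lookup-injective : ∀ {A : Set} (xs : List A) → Unique xs → ∀ i j → lookup xs i ≡ lookup xs j → i ≡ j
lookup-injective (x ∷ xs) (x∉xs ∷ u) Fin.zero Fin.zero e = refl
lookup-injective (x ∷ xs) (x∉xs ∷ u) Fin.zero (Fin.suc j) e = ⊥-elim (All.lookup x∉xs (∈-lookup j) e)
lookup-injective (x ∷ xs) (x∉xs ∷ u) (Fin.suc i) Fin.zero e = ⊥-elim (All.lookup x∉xs (∈-lookup i) (sym e))
lookup-injective (x ∷ xs) (x∉xs ∷ u) (Fin.suc i) (Fin.suc j) e = cong Fin.suc (lookup-injective xs u i j e)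

unique-snoc : ∀ {A : Set} (xs : List A) z → Unique xs → All (_≢ z) xs → Unique (xs ++ [ z ])
unique-snoc [] z _ _ = [] ∷ []
unique-snoc (x ∷ xs) z (x∉xs ∷ u) (x≢z ∷ xs≢z) = All.++⁺ x∉xs (x≢z ∷ []) ∷ unique-snoc xs z u xs≢z

skip : ℕ → ℕ → ℕ
skip a x with x <? a
... | yes _ = x
... | no  _ = suc x

skip-avoids : ∀ a x → skip a x ≢ a
skip-avoids a x with x <? a
... | yes x<a = λ x≡a → <-irrefl x≡a x<a
... | no  x≮a = λ x+1≡a → x≮a (subst (x <_) x+1≡a (n<1+n x))

skip-keepsAvoiding : ∀ {c h} y → c ≤ h → y ≢ c → skip h y ≢ c
skip-keepsAvoiding {c} {h} y c≤h y≢c with y <? h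
... | yes _   = y≢c
... | no  y≮h = λ y+1≡c → <-irrefl (sym y+1≡c) (s≤s (≤-trans c≤h (≮⇒≥ y≮h)))

skip-injective : ∀ a x y → skip a x ≡ skip a y → x ≡ y
skip-injective a x y e with x <? a | y <? a
... | yes _   | yes _   = e
... | no  _   | no  _   = suc-injective e
... | yes x<a | no  y≮a = ⊥-elim (y≮a (<-trans (subst (y <_) (sym e) (n<1+n y)) x<a))
... | no  x≮a | yes y<a = ⊥-elim (x≮a (<-trans (subst (x <_) e (n<1+n x)) y<a))

skip-≤ : ∀ a x → skip a x ≤ suc x
skip-≤ a x with x <? a
... | yes _ = n≤1+n x
... | no  _ = ≤-refl

-- avoid2 a b: an injection from ℕ into ℕ ∖ {a, b} moving each x by at most 2
-- (skip the smaller forbidden value first, then the larger).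
avoid2 : ℕ → ℕ → ℕ → ℕ
avoid2 a b x with a ≤? b
... | yes _ = skip b (skip a x)
... | no  _ = skip a (skip b x)

avoid2-avoids : ∀ a b x → avoid2 a b x ≢ a × avoid2 a b x ≢ b
avoid2-avoids a b x with a ≤? b
... | yes a≤b = skip-keepsAvoiding _ a≤b (skip-avoids a x) , skip-avoids b _
... | no  a≰b = skip-avoids a _ , skip-keepsAvoiding _ (≰⇒≥ a≰b) (skip-avoids b x)

avoid2-injective : ∀ a b x y → avoid2 a b x ≡ avoid2 a b y → x ≡ y
avoid2-injective a b x y e with a ≤? b
... | yes _ = skip-injective a x y (skip-injective b _ _ e)
... | no  _ = skip-injective b x y (skip-injective a _ _ e)

avoid2-≤ : ∀ a b x → avoid2 a b x ≤ suc (suc x)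
avoid2-≤ a b x with a ≤? b
... | yes _ = ≤-trans (skip-≤ b _) (s≤s (skip-≤ a x))
... | no  _ = ≤-trans (skip-≤ a _) (s≤s (skip-≤ b x))

distance≤2-cases : ∀ {G : Graph} {u v} → DistLeq G u v 2 →
                   u ≡ v ⊎ Adj G u v ⊎ ∃ λ m → Adj G u m × Adj G m v
distance≤2-cases (0 , _ , here) = inj₁ refl
distance≤2-cases (1 , _ , step a here) = inj₂ (inj₁ a)
distance≤2-cases (2 , _ , step a (step b here)) = inj₂ (inj₂ (_ , a , b))
distance≤2-cases (suc (suc (suc _)) , s≤s (s≤s ()) , _)

edge⇒distance≤2 : ∀ {G : Graph} {u v} → Adj G u v → DistLeq G u v 2
edge⇒distance≤2 a = 1 , s≤s z≤n , step a here

path⇒distance≤2 : ∀ {G : Graph} {u m v} → Adj G u m → Adj G m v → DistLeq G u v 2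
path⇒distance≤2 a b = 2 , ≤-refl , step a (step b here)

chain-snoc : ∀ {G : Graph} x ys y z → AdjChain G (x ∷ ys ++ [ y ]) → Adj G y z →
             AdjChain G (x ∷ (ys ++ [ y ]) ++ [ z ])
chain-snoc x [] y z (cons a (one .y)) b = cons a (cons b (one z))
chain-snoc x (w ∷ ws) y z (cons a rest) b = cons a (chain-snoc w ws y z rest b)

distColouring-lowerBound : (G : Graph) (k s m : ℕ) (f : Fin s → V G) →
  (∀ {i j} → f i ≡ f j → i ≡ j) → (∀ i j → f i ≢ f j → DistLeq G (f i) (f j) k) →
  (c : V G → Fin m) → IsDistColoring G k m c → s ≤ m
distColouring-lowerBound G k s m f f-inj close c ok = injective⇒≤ c∘f-inj
  where
  c∘f-inj : ∀ {i j} → c (f i) ≡ c (f j) → i ≡ j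
  c∘f-inj {i} {j} same with i FinP.≟ j
  ... | yes i≡j = i≡j
  ... | no  i≢j = ⊥-elim (ok (f i) (f j) fi≢fj (close i j fi≢fj) same)
    where fi≢fj : f i ≢ f j
          fi≢fj e = i≢j (f-inj e)

star⇒distance≤2 : ∀ {G : Graph} {c x y} →
  (x ≡ c ⊎ Adj G x c × Adj G c x) → (y ≡ c ⊎ Adj G y c × Adj G c y) → x ≢ y → DistLeq G x y 2
star⇒distance≤2 (inj₁ refl) (inj₁ refl) x≢y = ⊥-elim (x≢y refl)
star⇒distance≤2 (inj₁ refl) (inj₂ (_ , cy)) _ = edge⇒distance≤2 cy
star⇒distance≤2 (inj₂ (xc , _)) (inj₁ refl) _ = edge⇒distance≤2 xc
star⇒distance≤2 (inj₂ (xc , _)) (inj₂ (_ , cy)) _ = path⇒distance≤2 xc cy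

module EdgeFacts {t : ℕ} (G : SimpleGraph t) where

  -- An edge is determined by its pair of ends (the remaining fields are proofs).
  edge-≡ : ∀ (e f : Edge G) → ends {G = G} e ≡ ends {G = G} f → e ≡ f
  edge-≡ (p , lt , a) (.p , lt′ , a′) refl =
    cong₂ (λ x y → p , x , y) (FinP.<-irrelevant lt lt′) (Decidable⇒UIP.≡-irrelevant Bool._≟_ a a′)

  -- The ends of an edge are listed in increasing order, so no two edges have reversed ends.
  ends-notReversed : ∀ (e f : Edge G) {a b} → ends {G = G} e ≡ (a , b) → ends {G = G} f ≡ (b , a) → ⊥
  ends-notReversed e f e≡ f≡ = <-asym (subst ordered e≡ (proj₁ (proj₂ e))) (subst ordered f≡ (proj₁ (proj₂ f)))
    where
    ordered : Fin t × Fin t → Set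
    ordered p = toℕ (proj₁ p) < toℕ (proj₂ p)

  ends-adjacent : ∀ {u v} (e : Edge G) → IsEnd {G = G} u e → IsEnd {G = G} v e → u ≢ v →
                  adj G u v ≡ true
  ends-adjacent e (inj₁ refl) (inj₁ refl) u≢v = ⊥-elim (u≢v refl)
  ends-adjacent e (inj₁ refl) (inj₂ refl) _ = proj₂ (proj₂ e)
  ends-adjacent ((i , j) , _ , a) (inj₂ refl) (inj₁ refl) _ = trans (SimpleGraph.sym G j i) a
  ends-adjacent e (inj₂ refl) (inj₂ refl) u≢v = ⊥-elim (u≢v refl)

ProperEdgeColouring : ∀ {t} (G : SimpleGraph t) (b : ℕ) → (Edge G → Fin b) → Set
ProperEdgeColouring G b ce =
  ∀ {u} e f → IsEnd {G = G} u e → IsEnd {G = G} u f → ce e ≡ ce f → e ≡ f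

module CoronaColouring {t n : ℕ} (G : SimpleGraph t) (H : SimpleGraph n) where
  open EdgeFacts G

  coronaColour : ∀ {a b} → (Fin t → Fin a) → (Edge G → Fin b) → CoronaV G H → Fin (a + b * n)
  coronaColour {b = b} cv ce (inj₁ v) = cv v ↑ˡ (b * n)
  coronaColour {a} cv ce (inj₂ (e , x)) = a ↑ʳ combine (ce e) x

  ↑ˡ≢↑ʳ : ∀ {a c} (i : Fin a) (j : Fin c) → i ↑ˡ c ≢ a ↑ʳ j
  ↑ˡ≢↑ʳ {a} {c} i j eq with trans (sym (splitAt-↑ˡ a i c)) (trans (cong (splitAt a) eq) (splitAt-↑ʳ a c j))
  ... | ()

  -- Two vertices of G at distance ≤ 2 in G ◇ H are at distance ≤ 2 in G: a detour
  -- through a copy H_e joins the two (adjacent) ends of e.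
  distance-inG : ∀ {u v} → u ≢ v → DistLeq (edgeCorona G H) (inj₁ u) (inj₁ v) 2 →
                 DistLeq (toGraph G) u v 2
  distance-inG u≢v d with distance≤2-cases d
  ... | inj₁ refl = ⊥-elim (u≢v refl)
  ... | inj₂ (inj₁ uv) = edge⇒distance≤2 uv
  ... | inj₂ (inj₂ (inj₁ m , um , mv)) = path⇒distance≤2 um mv
  ... | inj₂ (inj₂ (inj₂ (e , _) , ue , ve)) = edge⇒distance≤2 (ends-adjacent e ue ve u≢v)

  -- Two vertices of copies H_e, H_f at distance ≤ 2 lie in the same copy, or e and f
  -- share an end vertex (the middle vertex of the connecting path).
  copies-close : ∀ {e f x y} → DistLeq (edgeCorona G H) (inj₂ (e , x)) (inj₂ (f , y)) 2 →
                 e ≡ f ⊎ ∃ λ u → IsEnd {G = G} u e × IsEnd {G = G} u f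
  copies-close d with distance≤2-cases d
  ... | inj₁ refl = inj₁ refl
  ... | inj₂ (inj₁ (same , _)) = inj₁ (edge-≡ _ _ same)
  ... | inj₂ (inj₂ (inj₁ u , ue , uf)) = inj₂ (u , ue , uf)
  ... | inj₂ (inj₂ (inj₂ _ , (eg , _) , (gf , _))) = inj₁ (edge-≡ _ _ (trans eg gf))

  coronaColour-2distance : ∀ {a b} (cv : Fin t → Fin a) (ce : Edge G → Fin b) →
    IsDistColoring (toGraph G) 2 a cv → ProperEdgeColouring G b ce →
    IsDistColoring (edgeCorona G H) 2 (a + b * n) (coronaColour cv ce)
  coronaColour-2distance {b = b} cv ce cv-ok ce-ok (inj₁ u) (inj₁ v) u≢v d same =
    cv-ok u v u≢v′ (distance-inG u≢v′ d) (↑ˡ-injective (b * n) (cv u) (cv v) same)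
    where u≢v′ : u ≢ v
          u≢v′ u≡v = u≢v (cong inj₁ u≡v)
  coronaColour-2distance cv ce _ _ (inj₁ u) (inj₂ (f , y)) _ _ same = ↑ˡ≢↑ʳ _ _ same
  coronaColour-2distance cv ce _ _ (inj₂ (e , x)) (inj₁ v) _ _ same = ↑ˡ≢↑ʳ _ _ (sym same)
  coronaColour-2distance {a} cv ce _ ce-ok (inj₂ (e , x)) (inj₂ (f , y)) ex≢fy d same
    with combine-injective (ce e) x (ce f) y (↑ʳ-injective a _ _ same)
  ... | ce≡ , refl = ex≢fy (cong (λ g → inj₂ (g , x)) e≡f)
    where
    e≡f : e ≡ f
    e≡f with copies-close d
    ... | inj₁ e≡f = e≡f
    ... | inj₂ (u , ue , uf) = ce-ok e f ue uf ce≡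

module StarLowerBound {t n : ℕ} (G : SimpleGraph t) (H : SimpleGraph n) (someVertex : Fin t) where

  CG : Graph
  CG = edgeCorona G H

  centreWithMaxDegree : Σ (Fin t) λ v → degree G v ≡ maxDegree G
  centreWithMaxDegree with maxOf-attained (degree G) (allFin t)
  ... | inj₂ attained = attained
  ... | inj₁ max≡0 =
    someVertex , ≤-antisym (≤-maxOf (degree G) (allFin t) (∈-allFin someVertex))
                           (subst (_≤ degree G someVertex) (sym max≡0) z≤n)

  centre : Fin t
  centre = proj₁ centreWithMaxDegree

  Δ : ℕ
  Δ = degree G centre

  neighbour : Fin Δ → Fin t
  neighbour = lookup (filter (λ j → T? (adj G centre j)) (allFin t))

  neighbour-adjacent : ∀ i → adj G centre (neighbour i) ≡ true
  neighbour-adjacent i =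
    Equivalence.to T-≡ (proj₂ (∈-filter⁻ (λ j → T? (adj G centre j)) {xs = allFin t} (∈-lookup i)))

  neighbour-injective : ∀ i j → neighbour i ≡ neighbour j → i ≡ j
  neighbour-injective = lookup-injective _ (Unique.filter⁺ (λ j → T? (adj G centre j)) (Unique.allFin⁺ t))

  centre≢neighbour : ∀ i → centre ≢ neighbour i
  centre≢neighbour i e
    with trans (sym (irrefl G centre)) (subst (λ v → adj G centre v ≡ true) (sym e) (neighbour-adjacent i))
  ... | ()

  spoke : Fin Δ → Edge G
  spoke i with FinP.<-cmp centre (neighbour i)
  ... | tri< lt _ _ = (centre , neighbour i) , lt , neighbour-adjacent i
  ... | tri≈ _ e _ = ⊥-elim (centre≢neighbour i e)
  ... | tri> _ _ gt = (neighbour i , centre) , gt ,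
                      trans (SimpleGraph.sym G (neighbour i) centre) (neighbour-adjacent i)

  centre-endOf-spoke : ∀ i → IsEnd {G = G} centre (spoke i)
  centre-endOf-spoke i with FinP.<-cmp centre (neighbour i)
  ... | tri< _ _ _ = inj₁ refl
  ... | tri≈ _ e _ = ⊥-elim (centre≢neighbour i e)
  ... | tri> _ _ _ = inj₂ refl

  spoke-injective : ∀ i j → ends {G = G} (spoke i) ≡ ends {G = G} (spoke j) → i ≡ j
  spoke-injective i j e with FinP.<-cmp centre (neighbour i) | FinP.<-cmp centre (neighbour j)
  ... | tri≈ _ c≡ _ | _ = ⊥-elim (centre≢neighbour i c≡)
  ... | _ | tri≈ _ c≡ _ = ⊥-elim (centre≢neighbour j c≡)
  ... | tri< _ _ _ | tri< _ _ _ = neighbour-injective i j (cong proj₂ e)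
  ... | tri> _ _ _ | tri> _ _ _ = neighbour-injective i j (cong proj₁ e)
  ... | tri< _ _ _ | tri> _ _ _ = ⊥-elim (centre≢neighbour j (cong proj₁ e))
  ... | tri> _ _ _ | tri< _ _ _ = ⊥-elim (centre≢neighbour i (sym (cong proj₁ e)))

  -- The star: the centre, and for each spoke its outer end and the n vertices of its copy of H.
  Star : Set
  Star = (Fin n ⊎ Fin 1) × Fin Δ ⊎ Fin 1

  starVertex : Star → V CG
  starVertex (inj₁ (inj₁ x , i)) = inj₂ (spoke i , x)
  starVertex (inj₁ (inj₂ _ , i)) = inj₁ (neighbour i)
  starVertex (inj₂ _) = inj₁ centre

  starVertex-injective : ∀ s s′ → starVertex s ≡ starVertex s′ → s ≡ s′
  starVertex-injective (inj₁ (inj₁ x , i)) (inj₁ (inj₁ y , j)) e =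
    cong₂ (λ x i → inj₁ (inj₁ x , i)) (cong proj₂ e′)
          (spoke-injective i j (cong (λ p → ends {G = G} (proj₁ p)) e′))
    where e′ = inj₂-injective e
  starVertex-injective (inj₁ (inj₂ Fin.zero , i)) (inj₁ (inj₂ Fin.zero , j)) e =
    cong (λ i → inj₁ (inj₂ Fin.zero , i)) (neighbour-injective i j (inj₁-injective e))
  starVertex-injective (inj₁ (inj₂ _ , i)) (inj₂ _) e = ⊥-elim (centre≢neighbour i (sym (inj₁-injective e)))
  starVertex-injective (inj₂ _) (inj₁ (inj₂ _ , i)) e = ⊥-elim (centre≢neighbour i (inj₁-injective e))
  starVertex-injective (inj₂ Fin.zero) (inj₂ Fin.zero) _ = refl
  starVertex-injective (inj₁ (inj₁ _ , _)) (inj₁ (inj₂ _ , _)) ()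
  starVertex-injective (inj₁ (inj₁ _ , _)) (inj₂ _) ()
  starVertex-injective (inj₁ (inj₂ _ , _)) (inj₁ (inj₁ _ , _)) ()
  starVertex-injective (inj₂ _) (inj₁ (inj₁ _ , _)) ()

  starVertex-nearCentre : ∀ s → starVertex s ≡ inj₁ centre ⊎
                          Adj CG (starVertex s) (inj₁ centre) × Adj CG (inj₁ centre) (starVertex s)
  starVertex-nearCentre (inj₁ (inj₁ x , i)) = inj₂ (centre-endOf-spoke i , centre-endOf-spoke i)
  starVertex-nearCentre (inj₁ (inj₂ _ , i)) =
    inj₂ (trans (SimpleGraph.sym G (neighbour i) centre) (neighbour-adjacent i) , neighbour-adjacent i)
  starVertex-nearCentre (inj₂ _) = inj₁ refl

  -- Star has (n + 1)·Δ + 1 elements: an injective indexing by Fin, through the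
  -- splittings Fin (p + q) ≅ Fin p ⊎ Fin q and Fin (p · q) ≅ Fin p × Fin q.
  starIndex : Fin ((n + 1) * Δ + 1) → Star
  starIndex i = Sum.map₁ (λ k → Product.map₁ (splitAt n) (remQuot Δ k)) (splitAt ((n + 1) * Δ) i)

  starIndex-injective : ∀ {i j} → starIndex i ≡ starIndex j → i ≡ j
  starIndex-injective {i} {j} e = begin
      i                       ≡⟨ sym (encode∘starIndex i) ⟩
      encode (starIndex i)    ≡⟨ cong encode e ⟩
      encode (starIndex j)    ≡⟨ encode∘starIndex j ⟩
      j                       ∎
    where
    open ≡-Reasoning
    encode : Star → Fin ((n + 1) * Δ + 1)
    encode (inj₁ (q , a)) = combine (join n 1 q) a ↑ˡ 1
    encode (inj₂ o) = (n + 1) * Δ ↑ʳ o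
    encode∘starIndex : ∀ i → encode (starIndex i) ≡ i
    encode∘starIndex i with splitAt ((n + 1) * Δ) i in split
    ... | inj₁ k = trans (cong (_↑ˡ 1) (trans
                      (cong (λ q → combine q (proj₂ (remQuot {n + 1} Δ k)))
                            (join-splitAt n 1 (proj₁ (remQuot {n + 1} Δ k))))
                      (combine-remQuot {n + 1} Δ k)))
                   (trans (cong (join ((n + 1) * Δ) 1) (sym split)) (join-splitAt ((n + 1) * Δ) 1 i))
    ... | inj₂ o = trans (cong (join ((n + 1) * Δ) 1) (sym split)) (join-splitAt ((n + 1) * Δ) 1 i)

  lowerBound : ∀ m (c : V CG → Fin m) → IsDistColoring CG 2 m c → (n + 1) * maxDegree G + 1 ≤ m
  lowerBound m c ok =
    subst (λ d → (n + 1) * d + 1 ≤ m) (proj₂ centreWithMaxDegree)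
      (distColouring-lowerBound CG 2 _ m member member-injective
        (λ i j → star⇒distance≤2 (starVertex-nearCentre (starIndex i)) (starVertex-nearCentre (starIndex j)))
        c ok)
    where
    member : Fin ((n + 1) * Δ + 1) → V CG
    member i = starVertex (starIndex i)
    member-injective : ∀ {i j} → member i ≡ member j → i ≡ j
    member-injective e = starIndex-injective (starVertex-injective _ _ e)

module RootedTree {t : ℕ} (T : SimpleGraph t) (isTree : IsTree T) where

  Adjacent : Fin t → Fin t → Set
  Adjacent u v = adj T u v ≡ true

  adjacent-sym : ∀ {u v} → Adjacent u v → Adjacent v u
  adjacent-sym {u} {v} a = trans (SimpleGraph.sym T v u) a

  adjacent-irrefl : ∀ {u v} → Adjacent u v → u ≢ v
  adjacent-irrefl {u} a refl with trans (sym (irrefl T u)) a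
  ... | ()

  root : Fin t
  root = fromℕ< (proj₁ isTree)

  Within : ℕ → Fin t → Set
  Within zero    v = v ≡ root
  Within (suc k) v = Within k v ⊎ ∃ λ u → Adjacent v u × Within k u

  within? : ∀ k v → Dec (Within k v)
  within? zero    v = v FinP.≟ root
  within? (suc k) v = within? k v ⊎-dec FinP.any? (λ u → (adj T v u Bool.≟ true) ×-dec within? k u)

  walk⇒within : ∀ {v ℓ} → Walk (toGraph T) v root ℓ → Within ℓ v
  walk⇒within here = refl
  walk⇒within (step a w) = inj₂ (_ , a , walk⇒within w)

  -- depth v: the distance from v to the root (T is connected, so it exists).
  leastWithin : ∀ v → Σ ℕ λ m → Within m v × (∀ j → j < m → ¬ Within j v)
  leastWithin v = leastSatisfying (λ k → Within k v) (λ k → within? k v) _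
                    (walk⇒within (proj₂ (proj₁ (proj₂ isTree) v root)))

  depth : Fin t → ℕ
  depth v = proj₁ (leastWithin v)

  within-depth : ∀ v → Within (depth v) v
  within-depth v = proj₁ (proj₂ (leastWithin v))

  within⇒depth≤ : ∀ {k v} → Within k v → depth v ≤ k
  within⇒depth≤ {k} {v} w = ≮⇒≥ (λ k<d → proj₂ (proj₂ (leastWithin v)) k k<d w)

  depth-adjacent : ∀ {v u} → Adjacent v u → depth v ≤ suc (depth u)
  depth-adjacent {v} {u} a = within⇒depth≤ (inj₂ (u , a , within-depth u))

  depth-root : depth root ≡ 0
  depth-root = n≤0⇒n≡0 (within⇒depth≤ {0} refl)

  depth≡0⇒root : ∀ {v} → depth v ≡ 0 → v ≡ root
  depth≡0⇒root {v} d≡0 = subst (λ k → Within k v) d≡0 (within-depth v)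

  positiveDepth⇒nonRoot : ∀ {v k} → depth v ≡ suc k → v ≢ root
  positiveDepth⇒nonRoot d≡ refl with trans (sym d≡) depth-root
  ... | ()

  shallower⇒≢ : ∀ {x y} → depth y < depth x → x ≢ y
  shallower⇒≢ lt refl = <-irrefl refl lt

  stepTowardsRoot : ∀ v k → depth v ≡ suc k → ∃ λ u → Adjacent v u × depth u ≡ k
  stepTowardsRoot v k d≡ with subst (λ m → Within m v) d≡ (within-depth v)
  ... | inj₁ w = ⊥-elim (<-irrefl refl (≤-<-trans (within⇒depth≤ w) (subst (k <_) (sym d≡) (n<1+n k))))
  ... | inj₂ (u , a , w) =
    u , a , ≤-antisym (within⇒depth≤ w) (≤-pred (subst (_≤ suc (depth u)) d≡ (depth-adjacent a)))

  parentAt : ∀ v m → depth v ≡ m → Fin t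
  parentAt v zero    _  = v
  parentAt v (suc k) d≡ = proj₁ (stepTowardsRoot v k d≡)

  parent : Fin t → Fin t
  parent v = parentAt v (depth v) refl

  parent-spec : ∀ {v} → v ≢ root → Adjacent v (parent v) × suc (depth (parent v)) ≡ depth v
  parent-spec {v} v≢r = go (depth v) refl
    where
    go : ∀ m (d≡ : depth v ≡ m) → Adjacent v (parentAt v m d≡) × suc (depth (parentAt v m d≡)) ≡ depth v
    go zero d≡ = ⊥-elim (v≢r (depth≡0⇒root d≡))
    go (suc k) d≡ = proj₁ (proj₂ up) , trans (cong suc (proj₂ (proj₂ up))) (sym d≡)
      where up = stepTowardsRoot v k d≡

  parent-adjacent : ∀ {v} → v ≢ root → Adjacent v (parent v)
  parent-adjacent v≢r = proj₁ (parent-spec v≢r)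

  depth-parent : ∀ {v} → v ≢ root → suc (depth (parent v)) ≡ depth v
  depth-parent v≢r = proj₂ (parent-spec v≢r)

  -- Two distinct vertices a, b at the same depth k are joined by a path
  -- a, y₁, …, yₗ, b (l ≥ 1) through strictly shallower vertices: climb from both
  -- through their parents until the two climbs meet.
  record Meeting (k : ℕ) (a b : Fin t) : Set where
    field
      inner    : List (Fin t)
      shallow  : All (λ y → depth y < k) inner
      chain    : AdjChain (toGraph T) (a ∷ inner ++ [ b ])
      distinct : Unique (a ∷ inner ++ [ b ])
      nonempty : 1 ≤ length inner

  framed-unique : ∀ {k a b ys} → depth a ≡ k → depth b ≡ k → a ≢ b →
                  All (λ y → depth y < k) ys → Unique ys → Unique (a ∷ ys ++ [ b ])
  framed-unique {a = a} {b} {ys} da db a≢b shallow u =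
    All.++⁺ (All.map (λ {y} dy → shallower⇒≢ (subst (depth y <_) (sym da) dy)) shallow) (a≢b ∷ [])
    ∷ unique-snoc ys b u (All.map (λ {y} dy y≡b → shallower⇒≢ (subst (depth y <_) (sym db) dy) (sym y≡b)) shallow)

  meeting : ∀ k a b → depth a ≡ k → depth b ≡ k → a ≢ b → Meeting k a b
  meeting zero a b da db a≢b = ⊥-elim (a≢b (trans (depth≡0⇒root da) (sym (depth≡0⇒root db))))
  meeting (suc k) a b da db a≢b = climb (parent a FinP.≟ parent b)
    where
    a≢r = positiveDepth⇒nonRoot da
    b≢r = positiveDepth⇒nonRoot db
    dpa : depth (parent a) ≡ k
    dpa = suc-injective (trans (depth-parent a≢r) da)
    dpb : depth (parent b) ≡ k
    dpb = suc-injective (trans (depth-parent b≢r) db)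
    pa< : depth (parent a) < suc k
    pa< = subst (_< suc k) (sym dpa) (n<1+n k)
    pb< : depth (parent b) < suc k
    pb< = subst (_< suc k) (sym dpb) (n<1+n k)
    pb→b : Adjacent (parent b) b
    pb→b = adjacent-sym (parent-adjacent b≢r)

    climb : Dec (parent a ≡ parent b) → Meeting (suc k) a b
    climb (yes same) = record
      { inner    = [ parent a ]
      ; shallow  = pa< ∷ []
      ; chain    = cons (parent-adjacent a≢r) (cons (subst (λ p → Adjacent p b) (sym same) pb→b) (one b))
      ; distinct = framed-unique da db a≢b (pa< ∷ []) ([] ∷ [])
      ; nonempty = s≤s z≤n }
    climb (no differ) = record
      { inner    = parent a ∷ M.inner ++ [ parent b ]
      ; shallow  = pa< ∷ All.++⁺ (All.map m<n⇒m<1+n M.shallow) (pb< ∷ [])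
      ; chain    = chain-snoc a (parent a ∷ M.inner) (parent b) b (cons (parent-adjacent a≢r) M.chain) pb→b
      ; distinct = framed-unique da db a≢b (pa< ∷ All.++⁺ (All.map m<n⇒m<1+n M.shallow) (pb< ∷ [])) M.distinct
      ; nonempty = s≤s z≤n }
      where module M = Meeting (meeting k (parent a) (parent b) dpa dpb differ)

  acyclic : ¬ HasCycle (toGraph T)
  acyclic = proj₂ (proj₂ isTree)

  -- Adjacent vertices lie at different depths: otherwise the edge closes the meeting path
  -- into a cycle.
  adjacent⇒depth≢ : ∀ {a b} → Adjacent a b → depth a ≢ depth b
  adjacent⇒depth≢ {a} {b} ab da≡db =
    acyclic (a , M.inner , b , M.nonempty , M.distinct , M.chain , adjacent-sym ab)
    where module M = Meeting (meeting (depth a) a b refl (sym da≡db) (adjacent-irrefl ab))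

  -- A vertex has only one neighbour one level closer to the root: two of them, with their
  -- meeting path, would close a cycle through v.
  upperNeighbour-unique : ∀ {v a b} → Adjacent v a → Adjacent v b →
                          suc (depth a) ≡ depth v → depth a ≡ depth b → a ≡ b
  upperNeighbour-unique {v} {a} {b} va vb da+1 da≡db with a FinP.≟ b
  ... | yes a≡b = a≡b
  ... | no  a≢b = ⊥-elim (acyclic (v , a ∷ M.inner , b , s≤s z≤n ,
                                   v∉path ∷ M.distinct , cons va M.chain , adjacent-sym vb))
    where
    module M = Meeting (meeting (depth a) a b refl (sym da≡db) a≢b)
    a<v : depth a < depth v
    a<v = subst (depth a <_) da+1 (n<1+n (depth a))
    v∉path : All (v ≢_) (a ∷ M.inner ++ [ b ])
    v∉path = shallower⇒≢ a<v
           ∷ All.++⁺ (All.map (λ dy → shallower⇒≢ (<-trans dy a<v)) M.shallow)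
                     (shallower⇒≢ (subst (_< depth v) da≡db a<v) ∷ [])

  upperNeighbour⇒parent : ∀ {u v} → Adjacent u v → suc (depth u) ≡ depth v → v ≢ root × u ≡ parent v
  upperNeighbour⇒parent {u} {v} uv du+1 = v≢r ,
    upperNeighbour-unique (adjacent-sym uv) (parent-adjacent v≢r) du+1
      (suc-injective (trans du+1 (sym (depth-parent v≢r))))
    where v≢r = positiveDepth⇒nonRoot (sym du+1)

  edge-parent : ∀ {u v} → Adjacent u v → (v ≢ root × u ≡ parent v) ⊎ (u ≢ root × v ≡ parent u)
  edge-parent {u} {v} uv with <-cmp (depth u) (depth v)
  ... | tri< du<dv _ _ = inj₁ (upperNeighbour⇒parent uv (≤-antisym du<dv (depth-adjacent (adjacent-sym uv))))
  ... | tri≈ _ du≡dv _ = ⊥-elim (adjacent⇒depth≢ uv du≡dv)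
  ... | tri> _ _ dv<du = inj₂ (upperNeighbour⇒parent (adjacent-sym uv) (≤-antisym dv<du (depth-adjacent uv)))

-- The
-- children of each vertex are numbered by `rank`, and a child's colour is its rank
-- shifted past the colours it must avoid.
module TreeColourings {t : ℕ} (T : SimpleGraph t) (isTree : IsTree T) where
  open RootedTree T isTree

  Δ : ℕ
  Δ = maxDegree T

  degree≤Δ : ∀ v → degree T v ≤ Δ
  degree≤Δ v = ≤-maxOf (degree T) (allFin t) (∈-allFin v)

  isChild : Fin t → Fin t → Bool
  isChild p j = adj T p j ∧ (depth j ≡ᵇ suc (depth p))

  childCount : Fin t → ℕ
  childCount p = count (isChild p) (allFin t)

  child-of-parent : ∀ {v} → v ≢ root → True (isChild (parent v) v)
  child-of-parent {v} v≢r =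
    ∧-intro (Equivalence.from T-≡ (adjacent-sym (parent-adjacent v≢r)))
            (≡⇒≡ᵇ (depth v) (suc (depth (parent v))) (sym (depth-parent v≢r)))

  parent-notChild : ∀ {p} → p ≢ root → ¬ True (isChild p (parent p))
  parent-notChild {p} p≢r c = <-irrefl loop (m<n⇒m<1+n (n<1+n (depth p)))
    where
    loop : depth p ≡ suc (suc (depth p))
    loop = trans (sym (depth-parent p≢r))
                 (cong suc (≡ᵇ⇒≡ (depth (parent p)) (suc (depth p)) (proj₂ (∧-split c))))

  -- Every vertex has at most Δ children, and a non-root vertex at most Δ − 1,
  -- since its parent is a neighbour but not a child.
  childCount≤Δ : ∀ p → childCount p ≤ Δ
  childCount≤Δ p = ≤-trans (count-mono (isChild p) (adj T p) (λ _ h → proj₁ (∧-split h)) (allFin t))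
                           (degree≤Δ p)

  childCount<Δ : ∀ {p} → p ≢ root → childCount p < Δ
  childCount<Δ {p} p≢r =
    <-≤-trans (count-strict (isChild p) (adj T p) (λ _ h → proj₁ (∧-split h)) (allFin t)
                (∈-allFin (parent p)) (Equivalence.from T-≡ (parent-adjacent p≢r)) (parent-notChild p≢r))
              (degree≤Δ p)

  rank : Fin t → ℕ
  rank v = position (isChild (parent v)) v

  rank<childCount : ∀ {v} → v ≢ root → rank v < childCount (parent v)
  rank<childCount {v} v≢r = position<count (isChild (parent v)) (child-of-parent v≢r)

  rank-injective : ∀ {a b} → a ≢ root → b ≢ root → parent a ≡ parent b → rank a ≡ rank b → a ≡ b
  rank-injective {a} {b} a≢r b≢r pa≡pb same =
    position-injective (isChild (parent a)) (child-of-parent a≢r)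
      (subst (λ p → True (isChild p b)) (sym pa≡pb) (child-of-parent b≢r))
      (trans same (cong (λ p → position (isChild p) b) (sym pa≡pb)))

  depth-childOfRoot : ∀ {v} → v ≢ root → parent v ≡ root → depth v ≡ 1
  depth-childOfRoot v≢r pv≡r = trans (sym (depth-parent v≢r)) (cong suc (trans (cong depth pv≡r) depth-root))

  depth-grandchild : ∀ {v} → v ≢ root → parent v ≢ root → depth v ≡ suc (suc (depth (parent (parent v))))
  depth-grandchild v≢r pv≢r = trans (sym (depth-parent v≢r)) (cong suc (sym (depth-parent pv≢r)))

  -- Edge colours, indexed by the child end of the edge: the edge from a child of the
  -- root gets its rank; a deeper edge gets its rank shifted past its parent edge's colour.
  edgeColourAt : ℕ → Fin t → ℕ
  edgeColourAt zero          v = 0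
  edgeColourAt (suc zero)    v = rank v
  edgeColourAt (suc (suc k)) v = skip (edgeColourAt (suc k) (parent v)) (rank v)

  edgeColour : Fin t → ℕ
  edgeColour v = edgeColourAt (depth v) v

  edgeColour-childOfRoot : ∀ {v} → v ≢ root → parent v ≡ root → edgeColour v ≡ rank v
  edgeColour-childOfRoot {v} v≢r pv≡r = cong (λ m → edgeColourAt m v) (depth-childOfRoot v≢r pv≡r)

  edgeColour-deeper : ∀ {v} → v ≢ root → parent v ≢ root →
                      edgeColour v ≡ skip (edgeColour (parent v)) (rank v)
  edgeColour-deeper {v} v≢r pv≢r = begin
    edgeColourAt (depth v) v
      ≡⟨ cong (λ m → edgeColourAt m v) (depth-grandchild v≢r pv≢r) ⟩
    skip (edgeColourAt (suc (depth (parent (parent v)))) (parent v)) (rank v)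
      ≡⟨ cong (λ m → skip (edgeColourAt m (parent v)) (rank v)) (depth-parent pv≢r) ⟩
    skip (edgeColour (parent v)) (rank v) ∎
    where open ≡-Reasoning

  vertexColourAt : ℕ → Fin t → ℕ
  vertexColourAt zero          v = 0
  vertexColourAt (suc zero)    v = suc (rank v)
  vertexColourAt (suc (suc k)) v =
    avoid2 (vertexColourAt (suc k) (parent v)) (vertexColourAt k (parent (parent v))) (rank v)

  vertexColour : Fin t → ℕ
  vertexColour v = vertexColourAt (depth v) v

  vertexColour-root : vertexColour root ≡ 0
  vertexColour-root = cong (λ m → vertexColourAt m root) depth-root

  vertexColour-childOfRoot : ∀ {v} → v ≢ root → parent v ≡ root → vertexColour v ≡ suc (rank v)
  vertexColour-childOfRoot {v} v≢r pv≡r = cong (λ m → vertexColourAt m v) (depth-childOfRoot v≢r pv≡r)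

  vertexColour-deeper : ∀ {v} → v ≢ root → parent v ≢ root →
    vertexColour v ≡ avoid2 (vertexColour (parent v)) (vertexColour (parent (parent v))) (rank v)
  vertexColour-deeper {v} v≢r pv≢r = begin
    vertexColourAt (depth v) v
      ≡⟨ cong (λ m → vertexColourAt m v) (depth-grandchild v≢r pv≢r) ⟩
    avoid2 (vertexColourAt (suc (depth (parent (parent v)))) (parent v)) (vertexColour (parent (parent v))) (rank v)
      ≡⟨ cong (λ m → avoid2 (vertexColourAt m (parent v)) (vertexColour (parent (parent v))) (rank v))
              (depth-parent pv≢r) ⟩
    avoid2 (vertexColour (parent v)) (vertexColour (parent (parent v))) (rank v) ∎
    where open ≡-Reasoning

  edgeColour-parent≢ : ∀ {v} → v ≢ root → parent v ≢ root → edgeColour v ≢ edgeColour (parent v)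
  edgeColour-parent≢ {v} v≢r pv≢r same = skip-avoids (edgeColour (parent v)) (rank v)
    (trans (sym (edgeColour-deeper v≢r pv≢r)) same)

  edgeColour-siblings : ∀ {a b} → a ≢ root → b ≢ root → parent a ≡ parent b →
                        edgeColour a ≡ edgeColour b → a ≡ b
  edgeColour-siblings {a} {b} a≢r b≢r pa≡pb same = rank-injective a≢r b≢r pa≡pb ranks
    where
    open ≡-Reasoning
    ranks : rank a ≡ rank b
    ranks with parent a FinP.≟ root
    ... | yes pa≡r = begin
      rank a       ≡⟨ sym (edgeColour-childOfRoot a≢r pa≡r) ⟩
      edgeColour a ≡⟨ same ⟩
      edgeColour b ≡⟨ edgeColour-childOfRoot b≢r (trans (sym pa≡pb) pa≡r) ⟩
      rank b       ∎
    ... | no pa≢r = skip-injective (edgeColour (parent a)) (rank a) (rank b) (begin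
      skip (edgeColour (parent a)) (rank a) ≡⟨ sym (edgeColour-deeper a≢r pa≢r) ⟩
      edgeColour a                          ≡⟨ same ⟩
      edgeColour b                          ≡⟨ edgeColour-deeper b≢r (λ pb≡r → pa≢r (trans pa≡pb pb≡r)) ⟩
      skip (edgeColour (parent b)) (rank b) ≡⟨ cong (λ p → skip (edgeColour p) (rank b)) (sym pa≡pb) ⟩
      skip (edgeColour (parent a)) (rank b) ∎)

  edgeColour<Δ : ∀ {v} → v ≢ root → edgeColour v < Δ
  edgeColour<Δ {v} v≢r with parent v FinP.≟ root
  ... | yes pv≡r = subst (_< Δ) (sym (edgeColour-childOfRoot v≢r pv≡r))
                     (<-≤-trans (rank<childCount v≢r) (childCount≤Δ (parent v)))
  ... | no  pv≢r = subst (_< Δ) (sym (edgeColour-deeper v≢r pv≢r))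
                     (≤-<-trans (≤-trans (skip-≤ (edgeColour (parent v)) (rank v)) (rank<childCount v≢r)) (childCount<Δ pv≢r))

  vertexColour-parent≢ : ∀ {v} → v ≢ root → vertexColour v ≢ vertexColour (parent v)
  vertexColour-parent≢ {v} v≢r with parent v FinP.≟ root
  ... | yes pv≡r = λ same → positive≢0 (begin
      suc (rank v)           ≡⟨ sym (vertexColour-childOfRoot v≢r pv≡r) ⟩
      vertexColour v         ≡⟨ same ⟩
      vertexColour (parent v) ≡⟨ cong vertexColour pv≡r ⟩
      vertexColour root      ≡⟨ vertexColour-root ⟩
      0                      ∎)
    where
    open ≡-Reasoning
    positive≢0 : ∀ {x} → suc x ≢ 0
    positive≢0 ()
  ... | no pv≢r = λ same → proj₁ (avoid2-avoids (vertexColour (parent v)) (vertexColour (parent (parent v))) (rank v)) (trans (sym (vertexColour-deeper v≢r pv≢r)) same)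

  vertexColour-grandparent≢ : ∀ {v} → v ≢ root → parent v ≢ root →
                              vertexColour v ≢ vertexColour (parent (parent v))
  vertexColour-grandparent≢ {v} v≢r pv≢r same =
    proj₂ (avoid2-avoids (vertexColour (parent v)) (vertexColour (parent (parent v))) (rank v)) (trans (sym (vertexColour-deeper v≢r pv≢r)) same)

  vertexColour-siblings : ∀ {a b} → a ≢ root → b ≢ root → parent a ≡ parent b →
                          vertexColour a ≡ vertexColour b → a ≡ b
  vertexColour-siblings {a} {b} a≢r b≢r pa≡pb same = rank-injective a≢r b≢r pa≡pb ranks
    where
    open ≡-Reasoning
    ranks : rank a ≡ rank b
    ranks with parent a FinP.≟ root
    ... | yes pa≡r = suc-injective (begin
      suc (rank a)   ≡⟨ sym (vertexColour-childOfRoot a≢r pa≡r) ⟩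
      vertexColour a ≡⟨ same ⟩
      vertexColour b ≡⟨ vertexColour-childOfRoot b≢r (trans (sym pa≡pb) pa≡r) ⟩
      suc (rank b)   ∎)
    ... | no pa≢r = avoid2-injective (vertexColour (parent a)) (vertexColour (parent (parent a))) (rank a) (rank b) (begin
      avoid2 (vertexColour (parent a)) (vertexColour (parent (parent a))) (rank a)
        ≡⟨ sym (vertexColour-deeper a≢r pa≢r) ⟩
      vertexColour a
        ≡⟨ same ⟩
      vertexColour b
        ≡⟨ vertexColour-deeper b≢r (λ pb≡r → pa≢r (trans pa≡pb pb≡r)) ⟩
      avoid2 (vertexColour (parent b)) (vertexColour (parent (parent b))) (rank b)
        ≡⟨ cong (λ p → avoid2 (vertexColour p) (vertexColour (parent p)) (rank b)) (sym pa≡pb) ⟩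
      avoid2 (vertexColour (parent a)) (vertexColour (parent (parent a))) (rank b) ∎)

  vertexColour≤Δ : ∀ v → vertexColour v ≤ Δ
  vertexColour≤Δ v with v FinP.≟ root
  ... | yes refl = subst (_≤ Δ) (sym vertexColour-root) z≤n
  ... | no v≢r with parent v FinP.≟ root
  ...   | yes pv≡r = subst (_≤ Δ) (sym (vertexColour-childOfRoot v≢r pv≡r))
                       (≤-trans (rank<childCount v≢r) (childCount≤Δ (parent v)))
  ...   | no  pv≢r = subst (_≤ Δ) (sym (vertexColour-deeper v≢r pv≢r))
                       (≤-trans (avoid2-≤ (vertexColour (parent v)) (vertexColour (parent (parent v))) (rank v)) (≤-trans (s≤s (rank<childCount v≢r)) (childCount<Δ pv≢r)))

  -- Vertices at distance 1 or 2 in T are parent and child, grandparent and grandchild,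
  -- or siblings; in each case their colours differ.
  vertexColour-2distance : ∀ {u w} → u ≢ w → (Adjacent u w ⊎ ∃ λ m → Adjacent u m × Adjacent m w) →
                           vertexColour u ≢ vertexColour w
  vertexColour-2distance {u} {w} u≢w (inj₁ uw) with edge-parent uw
  ... | inj₁ (w≢r , u≡pw) = λ same → vertexColour-parent≢ w≢r (trans (sym same) (cong vertexColour u≡pw))
  ... | inj₂ (u≢r , w≡pu) = λ same → vertexColour-parent≢ u≢r (trans same (cong vertexColour w≡pu))
  vertexColour-2distance {u} {w} u≢w (inj₂ (m , um , mw)) with edge-parent um | edge-parent mw
  ... | inj₁ (m≢r , u≡pm) | inj₁ (w≢r , m≡pw) = λ same →
        vertexColour-grandparent≢ w≢r (λ pw≡r → m≢r (trans m≡pw pw≡r))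
          (trans (sym same) (trans (cong vertexColour u≡pm) (cong (λ x → vertexColour (parent x)) m≡pw)))
  ... | inj₁ (_ , u≡pm) | inj₂ (_ , w≡pm) = ⊥-elim (u≢w (trans u≡pm (sym w≡pm)))
  ... | inj₂ (u≢r , m≡pu) | inj₁ (w≢r , m≡pw) = λ same →
        u≢w (vertexColour-siblings u≢r w≢r (trans (sym m≡pu) m≡pw) same)
  ... | inj₂ (u≢r , m≡pu) | inj₂ (m≢r , w≡pm) = λ same →
        vertexColour-grandparent≢ u≢r (λ pu≡r → m≢r (trans m≡pu pu≡r))
          (trans same (trans (cong vertexColour w≡pm) (cong (λ x → vertexColour (parent x)) m≡pu)))

  squareColouring : Fin t → Fin (suc Δ)
  squareColouring v = fromℕ< (s≤s (vertexColour≤Δ v))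

  squareColouring-2distance : IsDistColoring (toGraph T) 2 (suc Δ) squareColouring
  squareColouring-2distance u w u≢w d same with distance≤2-cases d
  ... | inj₁ u≡w = u≢w u≡w
  ... | inj₂ close = vertexColour-2distance u≢w close (FinP.fromℕ<-injective _ _ _ _ same)

  childEndOf : (e : Edge T) → Σ (Fin t) λ a → a ≢ root ×
               (ends {G = T} e ≡ (parent a , a) ⊎ ends {G = T} e ≡ (a , parent a))
  childEndOf ((i , j) , _ , ij) with edge-parent ij
  ... | inj₁ (j≢r , i≡pj) = j , j≢r , inj₁ (cong (_, j) i≡pj)
  ... | inj₂ (i≢r , j≡pi) = i , i≢r , inj₂ (cong (i ,_) j≡pi)

  childEnd : Edge T → Fin t
  childEnd e = proj₁ (childEndOf e)

  childEnd-nonRoot : ∀ e → childEnd e ≢ root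
  childEnd-nonRoot e = proj₁ (proj₂ (childEndOf e))

  end⇒childOrParent : ∀ {u} e → IsEnd {G = T} u e → u ≡ childEnd e ⊎ u ≡ parent (childEnd e)
  end⇒childOrParent e u-end with childEndOf e
  end⇒childOrParent e (inj₁ u≡i) | a , _ , inj₁ ends≡ = inj₂ (trans u≡i (cong proj₁ ends≡))
  end⇒childOrParent e (inj₂ u≡j) | a , _ , inj₁ ends≡ = inj₁ (trans u≡j (cong proj₂ ends≡))
  end⇒childOrParent e (inj₁ u≡i) | a , _ , inj₂ ends≡ = inj₁ (trans u≡i (cong proj₁ ends≡))
  end⇒childOrParent e (inj₂ u≡j) | a , _ , inj₂ ends≡ = inj₂ (trans u≡j (cong proj₂ ends≡))

  -- An edge is determined by its child end (its ends are listed in increasing order).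
  childEnd-injective : ∀ e f → childEnd e ≡ childEnd f → e ≡ f
  childEnd-injective e f same with childEndOf e | childEndOf f
  childEnd-injective e f refl | a , _ , inj₁ e≡ | .a , _ , inj₁ f≡ = EdgeFacts.edge-≡ T e f (trans e≡ (sym f≡))
  childEnd-injective e f refl | a , _ , inj₂ e≡ | .a , _ , inj₂ f≡ = EdgeFacts.edge-≡ T e f (trans e≡ (sym f≡))
  childEnd-injective e f refl | a , _ , inj₁ e≡ | .a , _ , inj₂ f≡ = ⊥-elim (EdgeFacts.ends-notReversed T e f e≡ f≡)
  childEnd-injective e f refl | a , _ , inj₂ e≡ | .a , _ , inj₁ f≡ = ⊥-elim (EdgeFacts.ends-notReversed T f e f≡ e≡)

  edgeColouring : Edge T → Fin Δ
  edgeColouring e = fromℕ< (edgeColour<Δ (childEnd-nonRoot e))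

  -- Two edges at a common vertex u: either u is the child end of one and the parent end
  -- of the other (parent-edge rule), or the parent end of both (sibling rule).
  edgeColouring-proper : ProperEdgeColouring T Δ edgeColouring
  edgeColouring-proper e f u-e u-f same =
    childEnd-injective e f (sameChild (end⇒childOrParent e u-e) (end⇒childOrParent f u-f))
    where
    a = childEnd e
    b = childEnd f
    colours : edgeColour a ≡ edgeColour b
    colours = FinP.fromℕ<-injective _ _ _ _ same
    sameChild : ∀ {u} → u ≡ a ⊎ u ≡ parent a → u ≡ b ⊎ u ≡ parent b → a ≡ b
    sameChild (inj₁ u≡a) (inj₁ u≡b) = trans (sym u≡a) u≡b
    sameChild (inj₁ u≡a) (inj₂ u≡pb) = ⊥-elim (edgeColour-parent≢ (childEnd-nonRoot f)
      (subst (_≢ root) a≡pb (childEnd-nonRoot e)) (trans (sym colours) (cong edgeColour a≡pb)))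
      where a≡pb = trans (sym u≡a) u≡pb
    sameChild (inj₂ u≡pa) (inj₁ u≡b) = ⊥-elim (edgeColour-parent≢ (childEnd-nonRoot e)
      (subst (_≢ root) b≡pa (childEnd-nonRoot f)) (trans colours (cong edgeColour b≡pa)))
      where b≡pa = trans (sym u≡b) u≡pa
    sameChild (inj₂ u≡pa) (inj₂ u≡pb) =
      edgeColour-siblings (childEnd-nonRoot e) (childEnd-nonRoot f) (trans (sym u≡pa) u≡pb) colours

colourCount : ∀ n Δ → suc Δ + Δ * n ≡ (n + 1) * Δ + 1
colourCount = solve-∀

mainTheorem3 : ∀ {t n} (T : SimpleGraph t) (H : SimpleGraph n) →
    IsTree T →
    ChiDist (edgeCorona T H) 2 ((n + 1) * maxDegree T + 1)
mainTheorem3 {t} {n} T H isTree = upperBound , StarLowerBound.lowerBound T H (RootedTree.root T isTree)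
  where
  open TreeColourings T isTree using (Δ; squareColouring; squareColouring-2distance; edgeColouring; edgeColouring-proper)
  open CoronaColouring T H using (coronaColour; coronaColour-2distance)
  upperBound : ∃[ c ] IsDistColoring (edgeCorona T H) 2 ((n + 1) * Δ + 1) c
  upperBound = subst (λ m → ∃[ c ] IsDistColoring (edgeCorona T H) 2 m c) (colourCount n Δ)
    ( coronaColour squareColouring edgeColouring
    , coronaColour-2distance squareColouring edgeColouring squareColouring-2distance edgeColouring-proper )
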